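{- Any deterministic streaming algorithm that verifies whether an integer array of length $n$ is a valid $\pi$ array (border array), or whether it is a valid $\pi'$ array (strict border array), requires $\Omega(n)$ bits of memory.
   Context: For a word $w$ of length $n$, $\pi_w[i]$ is the length of the longest proper border (a word that is both a proper prefix and a proper suffix) of $w[1\dots i]$. The strict border array $\pi'_w$ is defined by $\pi'_w[n]=\pi_w[n]$ and, for $i<n$, $\pi'_w[i]$ is the length of the longest proper border $u$ of $w[1\dots i]$ with $w[|u|+1]\neq w[i+1]$, or $-1$ if none exists. An array is a valid $\pi$ (resp. $\pi'$) array if it equals $\pi_w$ (resp. $\pi'_w$) for some word $w$ over some alphabet. In the streaming setting, the input values are given one by one and cannot be re-read. -}

module Defs where

open import Data.Nat using (ℕ; zero; suc; _+_; _*_; _∸_; _≤_; _<_)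
open import Data.Nat.Logarithm using (⌈log₂_⌉)
open import Data.Integer using (ℤ; +_; -[1+_])
open import Data.Fin using (Fin; toℕ)
open import Data.Vec using (Vec; lookup; toList)
open import Data.List using (foldl)
open import Data.Bool using (Bool; true)
open import Data.Product using (Σ; _×_)
open import Data.Sum using (_⊎_)
open import Relation.Nullary using (¬_)
open import Relation.Binary.PropositionalEquality using (_≡_; _≢_)

-- Words are ℕ → ℕ (letters are naturals); only positions 0 … n-1 matter.
-- Positions are 0-indexed; the prefix w[1..i] of the paper is w 0 … w (i-1).
Word : Set
Word = ℕ → ℕ

IsBorder : Word → ℕ → ℕ → Set
IsBorder w i b = b < i × (∀ j → j < b → w j ≡ w (i ∸ b + j))

Longest : (ℕ → Set) → ℕ → Set
Longest P b = P b × (∀ b′ → P b′ → b′ ≤ b)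

PiAt : Word → ℕ → ℕ → Set
PiAt w i b = Longest (IsBorder w i) b

-- a proper border u of w[1..i] with w[|u|+1] ≠ w[i+1]  (0-indexed: w b ≠ w i)
IsStrictBorder : Word → ℕ → ℕ → Set
IsStrictBorder w i b = IsBorder w i b × w b ≢ w i

-- a is the π array of w (a[k] corresponds to prefix length k+1)
IsPiArrayOf : ∀ {n} → Word → Vec ℤ n → Set
IsPiArrayOf {n} w a =
  ∀ (k : Fin n) → Σ ℕ λ b → lookup a k ≡ + b × PiAt w (suc (toℕ k)) b

IsStrictPiArrayOf : ∀ {n} → Word → Vec ℤ n → Set
IsStrictPiArrayOf {n} w a =
  ∀ (k : Fin n) →
    (suc (toℕ k) ≡ n → Σ ℕ λ b → lookup a k ≡ + b × PiAt w (suc (toℕ k)) b)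
  × (suc (toℕ k) < n →
       (Σ ℕ λ b → lookup a k ≡ + b × Longest (IsStrictBorder w (suc (toℕ k))) b)
     ⊎ (lookup a k ≡ -[1+ 0 ] × (∀ b → ¬ IsStrictBorder w (suc (toℕ k)) b)))

ValidPi : ∀ {n} → Vec ℤ n → Set
ValidPi a = Σ Word λ w → IsPiArrayOf w a

ValidStrictPi : ∀ {n} → Vec ℤ n → Set
ValidStrictPi a = Σ Word λ w → IsStrictPiArrayOf w a

-- A deterministic streaming algorithm with m memory states (⌈log₂ m⌉ bits):
-- it reads the input values one at a time and can only keep its state.
record Streaming (m : ℕ) : Set where
  field
    init   : Fin m
    step   : Fin m → ℤ → Fin m
    accept : Fin m → Bool

run : ∀ {m n} → Streaming m → Vec ℤ n → Fin m
run A a = foldl (Streaming.step A) (Streaming.init A) (toList a)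

Decides : ∀ {m} → Streaming m → (n : ℕ) → (Vec ℤ n → Set) → Set
Decides A n P =
  ∀ (a : Vec ℤ n) → (Streaming.accept A (run A a) ≡ true → P a)
                  × (P a → Streaming.accept A (run A a) ≡ true)

memoryBits : ℕ → ℕ
memoryBits m = ⌈log₂ m ⌉

module Submission where

-- Fooling-set argument.  Split the input as n = (2 + L) + r with r ≥ 3 + L.
-- A bit string β ∈ {0,1}^L is encoded by the word  encode β = 0 2 β₀ … β_{L-1} 0 0 …,
-- whose letter 2 occurs only at position 1; its prefix is the first 2 + L
-- entries of the (strict) border array of encode β.  For γ with γⱼ = 1 the probe
-- word  u[0..2+L) · u[0..2+j) · u₀ u₀ …  (u = encode γ) has the same first 2 + L
-- entries as u, and longest (strict) borders 2+j and 1 at prefix lengths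
-- 2+L+2+j and 2+L+3+j.  For β with βⱼ = 0, encode β has border 1 at prefix
-- length 3+j.  No word has these three borders: the two borders of length 1
-- force the letters after the copy to agree, so the copy 2+j would extend to a
-- border 3+j (resp. would not be strict).  Hence the suffix of the probe of γ
-- separates the prefixes of γ and β, a correct algorithm reaches 2^L distinct
-- states after the 2^L prefixes, and so it uses at least L ≥ n/5 bits.

open import Defs
open import Data.Nat using (ℕ; zero; suc; _+_; _*_; _∸_; _^_; _≤_; _<_; z≤n; s≤s; s≤s⁻¹; _≟_; _<?_; _≤?_; pred)
open import Data.Nat.Properties
open import Data.Nat.Logarithm using (⌈log₂⌉-mono-≤; ⌈log₂2^n⌉≡n)
open import Data.Integer using (ℤ; +_; -[1+_])
open import Data.Fin as Fin using (Fin; toℕ; fromℕ<; _↑ˡ_; _↑ʳ_; finToFun; funToFin; combine)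
open import Data.Fin.Patterns using (0F; 1F)
open import Data.Fin.Properties using (toℕ<n; toℕ-fromℕ<; toℕ-↑ˡ; toℕ-↑ʳ; injective⇒≤; ¬∀⟶∃¬; funToFin-finToFin)
open import Data.Vec using (Vec; []; _∷_; _++_; lookup; toList)
open import Data.Vec.Properties using (toList-++; lookup-++ˡ; lookup-++ʳ)
open import Data.List using (foldl)
open import Data.List.Properties using (foldl-++)
open import Data.Bool using (true)
open import Data.Product using (Σ; _×_; _,_; proj₁; proj₂)
open import Data.Sum using (_⊎_; inj₁; inj₂; [_,_]′)
open import Data.Empty using (⊥; ⊥-elim)
open import Function using (_∘_; id)
open import Function.Definitions using (Injective)
open import Relation.Nullary using (¬_; yes; no; contradiction)
open import Relation.Nullary.Decidable using (_×-dec_; ¬?; map′)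
open import Relation.Unary using (Decidable)
open import Relation.Binary.PropositionalEquality

variable
  w w′ z u : Word
  i j k p q r t b v : ℕ
  P Q : ℕ → Set

LongestValue : (ℕ → Set) → ℤ → Set
LongestValue P x = Σ ℕ λ b → x ≡ + b × Longest P b

LongestOrNone : (ℕ → Set) → ℤ → Set
LongestOrNone P x = LongestValue P x ⊎ (x ≡ -[1+ 0 ] × (∀ b → ¬ P b))

longest : (P : ℕ → Set) → Decidable P → ∀ i → (∀ b → P b → b < i) → Σ ℤ (LongestOrNone P)
longest P P? zero bounded = -[1+ 0 ] , inj₂ (refl , λ b pb → n≮0 (bounded b pb))
longest P P? (suc i) bounded with P? i
... | yes pi = + i , inj₁ (i , refl , pi , λ b pb → s≤s⁻¹ (bounded b pb))
... | no ¬pi = longest P P? i (λ b pb → ≤∧≢⇒< (s≤s⁻¹ (bounded b pb)) λ { refl → ¬pi pb })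

longest-unique : (∀ b → P b → Q b) → (∀ b → Q b → P b) → Longest P v → Longest Q t → v ≡ t
longest-unique P⇒Q Q⇒P (pv , maxP) (qt , maxQ) = ≤-antisym (maxQ _ (P⇒Q _ pv)) (maxP _ (Q⇒P _ qt))

longestOrNone-unique : ∀ {x y} → (∀ b → P b → Q b) → (∀ b → Q b → P b) →
  LongestOrNone P x → LongestOrNone Q y → x ≡ y
longestOrNone-unique P⇒Q Q⇒P (inj₁ (_ , refl , lp)) (inj₁ (_ , refl , lq)) =
  cong +_ (longest-unique P⇒Q Q⇒P lp lq)
longestOrNone-unique P⇒Q Q⇒P (inj₁ (b , _ , pb , _)) (inj₂ (_ , noQ)) = ⊥-elim (noQ b (P⇒Q b pb))
longestOrNone-unique P⇒Q Q⇒P (inj₂ (_ , noP)) (inj₁ (b , _ , qb , _)) = ⊥-elim (noP b (Q⇒P b qb))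
longestOrNone-unique P⇒Q Q⇒P (inj₂ (refl , _)) (inj₂ (refl , _)) = refl

longestOrNone-≡ : ∀ {x} → LongestOrNone P x → Longest P v → x ≡ + v
longestOrNone-≡ spec lv = longestOrNone-unique (λ _ → id) (λ _ → id) spec (inj₁ (_ , refl , lv))

longestValue-+ : LongestValue P (+ v) → Longest P v
longestValue-+ (_ , refl , lv) = lv

longestOrNone-+ : LongestOrNone P (+ v) → Longest P v
longestOrNone-+ (inj₁ value) = longestValue-+ value
longestOrNone-+ (inj₂ (() , _))

-- Borders

border? : ∀ w i → Decidable (IsBorder w i)
border? w i b = (b <? i) ×-dec map′ (λ all j → all {j}) (λ all {j} → all j)
                                     (allUpTo? (λ j → w j ≟ w (i ∸ b + j)) b)

strictBorder? : ∀ w i → Decidable (IsStrictBorder w i)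
strictBorder? w i b = border? w i b ×-dec ¬? (w b ≟ w i)

border-local : (∀ q → q < i → w q ≡ w′ q) → IsBorder w i b → IsBorder w′ i b
border-local {i = i} {b = b} agree (b<i , match) = b<i , λ j j<b →
  trans (sym (agree j (<-trans j<b b<i))) (trans (match j j<b) (agree (i ∸ b + j) (inside j<b)))
  where
  inside : ∀ {j} → j < b → i ∸ b + j < i
  inside {j} j<b = subst (i ∸ b + j <_) (m∸n+n≡m (<⇒≤ b<i)) (+-monoʳ-< (i ∸ b) j<b)

strictBorder-local : (∀ q → q ≤ i → w q ≡ w′ q) → IsStrictBorder w i b → IsStrictBorder w′ i b
strictBorder-local agree (border , differ) =
  border-local (λ q q<i → agree q (<⇒≤ q<i)) border ,
  λ same → differ (trans (agree _ (<⇒≤ (proj₁ border))) (trans same (sym (agree _ ≤-refl))))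

border1 : IsBorder w (suc i) 1 → w 0 ≡ w i
border1 {w = w} {i = i} (_ , match) = trans (match 0 (s≤s z≤n)) (cong w (+-identityʳ i))

border1-intro : 1 ≤ i → w 0 ≡ w i → IsBorder w (suc i) 1
border1-intro {i = i} {w = w} 1≤i same = s≤s 1≤i , λ
  { zero _ → trans same (cong w (sym (+-identityʳ i)))
  ; (suc _) (s≤s ()) }

border-extend : IsBorder w i b → w b ≡ w i → IsBorder w (suc i) (suc b)
border-extend {w = w} {i = i} {b = b} (b<i , match) same = s≤s b<i , extended
  where
  extended : ∀ t → t < suc b → w t ≡ w (i ∸ b + t)
  extended t t≤b with m≤n⇒m<n∨m≡n (s≤s⁻¹ t≤b)
  ... | inj₁ t<b = match t t<b
  ... | inj₂ refl = trans same (cong w (sym (m∸n+n≡m (<⇒≤ b<i))))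

marker-border : ∀ {a} → w 1 ≡ a → (∀ q → w q ≡ a → q ≡ 1 ⊎ q ≡ p + 1) →
  ∀ {c} → IsBorder w i c → 2 ≤ c → i ≡ p + c
marker-border {w = w} {p = p} {i = i} w₁ only {c} (c<i , match) 2≤c
  with only (i ∸ c + 1) (trans (sym (match 1 2≤c)) w₁)
... | inj₁ start≡1 =
  contradiction (m∸n≡0⇒m≤n (cong pred (trans (+-comm 1 (i ∸ c)) start≡1))) (<⇒≱ c<i)
... | inj₂ start≡p+1 = begin
  i           ≡⟨ m∸n+n≡m (<⇒≤ c<i) ⟨
  i ∸ c + c   ≡⟨ cong (_+ c) (+-cancelʳ-≡ 1 (i ∸ c) p start≡p+1) ⟩
  p + c       ∎
  where open ≡-Reasoning

longest-by-marker : ∀ {a} → w 1 ≡ a → (∀ q → w q ≡ a → q ≡ 1 ⊎ q ≡ p + 1) →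
  IsBorder w i v → 1 ≤ v → (∀ c → i ≡ p + c → IsBorder w i c → c ≤ v) → PiAt w i v
longest-by-marker {w = w} {i = i} {v = v} w₁ only border 1≤v aligned = border , dominated
  where
  dominated : ∀ c → IsBorder w i c → c ≤ v
  dominated c bc with c ≤? 1
  ... | yes c≤1 = ≤-trans c≤1 1≤v
  ... | no c≰1 = aligned c (marker-border w₁ only bc (≰⇒> c≰1)) bc

strictify : PiAt w i v → w v ≢ w i → Longest (IsStrictBorder w i) v
strictify (border , maximal) differ = (border , differ) , λ c sc → maximal c (proj₁ sc)

piEntry : Word → ℕ → ℤ
piEntry w k = proj₁ (longest (IsBorder w (suc k)) (border? w (suc k)) (suc k) (λ _ → proj₁))

strictValue : Word → ℕ → ℤ
strictValue w i = proj₁ (longest (IsStrictBorder w i) (strictBorder? w i) i (λ _ → proj₁ ∘ proj₁))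

strictEntry : ℕ → Word → ℕ → ℤ
strictEntry n w k with suc k ≟ n
... | yes _ = piEntry w k
... | no _ = strictValue w (suc k)

PiEntry : Word → ℕ → ℤ → Set
PiEntry z k x = LongestValue (IsBorder z (suc k)) x

StrictEntry : ℕ → Word → ℕ → ℤ → Set
StrictEntry n z k x =
  (suc k ≡ n → PiEntry z k x) × (suc k < n → LongestOrNone (IsStrictBorder z (suc k)) x)

piEntry-spec : ∀ w k → PiEntry w k (piEntry w k)
piEntry-spec w k with longest (IsBorder w (suc k)) (border? w (suc k)) (suc k) (λ _ → proj₁)
... | _ , inj₁ value = value
... | _ , inj₂ (_ , noBorder) = ⊥-elim (noBorder 0 (s≤s z≤n , λ _ ()))

strictValue-spec : ∀ w i → LongestOrNone (IsStrictBorder w i) (strictValue w i)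
strictValue-spec w i = proj₂ (longest (IsStrictBorder w i) (strictBorder? w i) i (λ _ → proj₁ ∘ proj₁))

strictEntry-spec : ∀ n w k → StrictEntry n w k (strictEntry n w k)
strictEntry-spec n w k with suc k ≟ n
... | yes last = (λ _ → piEntry-spec w k) , (λ k+1<n → contradiction last (<⇒≢ k+1<n))
... | no notLast = (λ last → contradiction last notLast) , (λ _ → strictValue-spec w (suc k))

strictEntry-< : ∀ n w k → suc k < n → strictEntry n w k ≡ strictValue w (suc k)
strictEntry-< n w k k+1<n with suc k ≟ n
... | yes last = contradiction last (<⇒≢ k+1<n)
... | no _ = refl

piEntry-≡ : PiAt w (suc k) v → piEntry w k ≡ + v
piEntry-≡ {w = w} {k = k} = longestOrNone-≡ (inj₁ (piEntry-spec w k))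

strictValue-≡ : Longest (IsStrictBorder w i) v → strictValue w i ≡ + v
strictValue-≡ {w = w} {i = i} = longestOrNone-≡ (strictValue-spec w i)

piEntry-local : ∀ k → (∀ q → q ≤ suc k → w q ≡ w′ q) → piEntry w k ≡ piEntry w′ k
piEntry-local {w = w} {w′ = w′} k agree = longestOrNone-unique
  (λ _ → border-local λ q q<i → agree q (<⇒≤ q<i))
  (λ _ → border-local λ q q<i → sym (agree q (<⇒≤ q<i)))
  (inj₁ (piEntry-spec w k)) (inj₁ (piEntry-spec w′ k))

strictEntry-local : ∀ n k → (∀ q → q ≤ suc k → w q ≡ w′ q) → strictEntry n w k ≡ strictEntry n w′ k
strictEntry-local {w = w} {w′ = w′} n k agree with suc k ≟ n
... | yes _ = piEntry-local k agree
... | no _ = longestOrNone-unique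
  (λ _ → strictBorder-local agree) (λ _ → strictBorder-local (λ q q≤ → sym (agree q q≤)))
  (strictValue-spec w (suc k)) (strictValue-spec w′ (suc k))

window : (ℕ → ℤ) → ℕ → (n : ℕ) → Vec ℤ n
window f s zero = []
window f s (suc n) = f s ∷ window f (suc s) n

lookup-window : ∀ f s n (k : Fin n) → lookup (window f s n) k ≡ f (s + toℕ k)
lookup-window f s (suc n) Fin.zero = cong f (sym (+-identityʳ s))
lookup-window f s (suc n) (Fin.suc k) =
  trans (lookup-window f (suc s) n k) (cong f (sym (+-suc s (toℕ k))))

window-++ : ∀ f s p r → window f s (p + r) ≡ window f s p ++ window f (s + p) r
window-++ f s zero r = cong (λ s′ → window f s′ r) (sym (+-identityʳ s))
window-++ f s (suc p) r = cong (f s ∷_) (trans (window-++ f (suc s) p r)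
  (cong (λ s′ → window f (suc s) p ++ window f s′ r) (sym (+-suc s p))))

window-cong : ∀ {f g} s n → (∀ k → k < s + n → f k ≡ g k) → window f s n ≡ window g s n
window-cong s zero agree = refl
window-cong s (suc n) agree = cong₂ _∷_ (agree s (m<m+n s (s≤s z≤n)))
  (window-cong (suc s) n λ k k< → agree k (subst (k <_) (sym (+-suc s n)) k<))

Entrywise : ∀ {n} → (ℕ → ℤ → Set) → Vec ℤ n → Set
Entrywise {n} Q a = ∀ (k : Fin n) → Q (toℕ k) (lookup a k)

window-entrywise : ∀ {R : ℕ → ℤ → Set} {f} n → (∀ k → R k (f k)) → Entrywise R (window f 0 n)
window-entrywise {R = R} {f = f} n correct k =
  subst (R (toℕ k)) (sym (lookup-window f 0 n k)) (correct (toℕ k))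

read-left : ∀ {R : ℕ → ℤ → Set} {f g} → Entrywise R (window f 0 p ++ window g p r) →
  k < p → R k (f k)
read-left {p = p} {r = r} {k = k} {R = R} {f = f} {g = g} correct k<p =
  subst₂ R position entry (correct (slot ↑ˡ r))
  where
  slot : Fin p
  slot = fromℕ< k<p
  position : toℕ (slot ↑ˡ r) ≡ k
  position = trans (toℕ-↑ˡ slot r) (toℕ-fromℕ< k<p)
  entry : lookup (window f 0 p ++ window g p r) (slot ↑ˡ r) ≡ f k
  entry = trans (lookup-++ˡ (window f 0 p) (window g p r) slot)
                (trans (lookup-window f 0 p slot) (cong f (toℕ-fromℕ< k<p)))

read-right : ∀ {R : ℕ → ℤ → Set} {f g} → Entrywise R (window f 0 p ++ window g p r) →
  t < r → R (p + t) (g (p + t))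
read-right {p = p} {r = r} {t = t} {R = R} {f = f} {g = g} correct t<r =
  subst₂ R position entry (correct (p ↑ʳ slot))
  where
  slot : Fin r
  slot = fromℕ< t<r
  position : toℕ (p ↑ʳ slot) ≡ p + t
  position = trans (toℕ-↑ʳ p slot) (cong (λ t′ → p + t′) (toℕ-fromℕ< t<r))
  entry : lookup (window f 0 p ++ window g p r) (p ↑ʳ slot) ≡ g (p + t)
  entry = trans (lookup-++ʳ (window f 0 p) (window g p r) slot)
                (trans (lookup-window g p r slot) (cong (λ t′ → g (p + t′)) (toℕ-fromℕ< t<r)))

piArray-valid : ∀ n w → ValidPi (window (piEntry w) 0 n)
piArray-valid n w = w , window-entrywise {R = PiEntry w} n (piEntry-spec w)

strictArray-valid : ∀ n w → ValidStrictPi (window (strictEntry n w) 0 n)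
strictArray-valid n w = w , window-entrywise {R = StrictEntry n w} n (strictEntry-spec n w)

-- Fooling sets for streaming algorithms

module _ {m} (A : Streaming m) where
  open Streaming A

  run-++ : ∀ {p r} (u : Vec ℤ p) (s : Vec ℤ r) → run A (u ++ s) ≡ foldl step (run A u) (toList s)
  run-++ u s = trans (cong (foldl step init) (toList-++ u s)) (foldl-++ step init (toList u) (toList s))

  Separates : ∀ {p r} → (Vec ℤ (p + r) → Set) → Vec ℤ p → Vec ℤ p → Vec ℤ r → Set
  Separates Prop u u′ s = Prop (u ++ s) × ¬ Prop (u′ ++ s)

  separated-states : ∀ {p r Prop} {u u′ : Vec ℤ p} {s : Vec ℤ r} → Decides A (p + r) Prop →
    Separates Prop u u′ s → run A u ≢ run A u′
  separated-states {u = u} {u′} {s} decides (yes-u , no-u′) same = no-u′ (proj₁ (decides (u′ ++ s)) accepted)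
    where
    open ≡-Reasoning
    accepted : accept (run A (u′ ++ s)) ≡ true
    accepted = begin
      accept (run A (u′ ++ s))                   ≡⟨ cong accept (run-++ u′ s) ⟩
      accept (foldl step (run A u′) (toList s))  ≡⟨ cong (λ q → accept (foldl step q (toList s))) same ⟨
      accept (foldl step (run A u) (toList s))   ≡⟨ cong accept (run-++ u s) ⟨
      accept (run A (u ++ s))                    ≡⟨ proj₂ (decides (u ++ s)) yes-u ⟩
      true                                       ∎

  fooling-bound : ∀ {p r L Prop} → Decides A (p + r) Prop → (pre : Fin (2 ^ L) → Vec ℤ p) →
    (∀ k k′ → k ≢ k′ → Σ (Vec ℤ r) (Separates Prop (pre k) (pre k′))
                      ⊎ Σ (Vec ℤ r) (Separates Prop (pre k′) (pre k))) →
    L ≤ memoryBits m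
  fooling-bound {L = L} decides pre separable =
    subst (_≤ memoryBits m) (⌈log₂2^n⌉≡n L) (⌈log₂⌉-mono-≤ (injective⇒≤ states-distinct))
    where
    states-distinct : Injective _≡_ _≡_ (λ k → run A (pre k))
    states-distinct {k} {k′} same with k Fin.≟ k′
    ... | yes k≡k′ = k≡k′
    ... | no k≢k′ = ⊥-elim ([ (λ (s , sep) → separated-states {u = pre k} {pre k′} {s} decides sep same)
                            , (λ (s , sep) → separated-states {u = pre k′} {pre k} {s} decides sep (sym same))
                            ]′ (separable k k′ k≢k′))

bitsOf : ∀ {L} → Fin (2 ^ L) → Fin L → Fin 2
bitsOf = finToFun

funToFin-cong : ∀ {L} {β γ : Fin L → Fin 2} → (∀ j → β j ≡ γ j) → funToFin β ≡ funToFin γ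
funToFin-cong {zero} same = refl
funToFin-cong {suc L} same = cong₂ combine (same Fin.zero) (funToFin-cong (same ∘ Fin.suc))

differing-bit : ∀ {L} {k k′ : Fin (2 ^ L)} → k ≢ k′ → Σ (Fin L) λ j → bitsOf k j ≢ bitsOf k′ j
differing-bit {L} {k} {k′} k≢k′ =
  ¬∀⟶∃¬ L _ (λ j → bitsOf k j Fin.≟ bitsOf k′ j) λ same → k≢k′ (begin
    k                               ≡⟨ funToFin-finToFin {L} {2} k ⟨
    funToFin (finToFun {2} {L} k)   ≡⟨ funToFin-cong same ⟩
    funToFin (finToFun {2} {L} k′)  ≡⟨ funToFin-finToFin {L} {2} k′ ⟩
    k′                              ∎)
  where open ≡-Reasoning

distinct-bits : ∀ {a b : Fin 2} → a ≢ b → (a ≡ 0F × b ≡ 1F) ⊎ (a ≡ 1F × b ≡ 0F)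
distinct-bits {0F} {0F} a≢b = contradiction refl a≢b
distinct-bits {0F} {1F} a≢b = inj₁ (refl , refl)
distinct-bits {1F} {0F} a≢b = inj₂ (refl , refl)
distinct-bits {1F} {1F} a≢b = contradiction refl a≢b

-- The encoding words and the probe words

-- the bit at position i as a letter 0/1, and 0 past the end
bitAt : ∀ {L} → (Fin L → Fin 2) → ℕ → ℕ
bitAt {zero} β i = 0
bitAt {suc L} β zero = toℕ (β Fin.zero)
bitAt {suc L} β (suc i) = bitAt (β ∘ Fin.suc) i

bitAt-toℕ : ∀ {L} (β : Fin L → Fin 2) j → bitAt β (toℕ j) ≡ toℕ (β j)
bitAt-toℕ β Fin.zero = refl
bitAt-toℕ β (Fin.suc j) = bitAt-toℕ (β ∘ Fin.suc) j

bitAt-end : ∀ {L} (β : Fin L → Fin 2) → bitAt β L ≡ 0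
bitAt-end {zero} β = refl
bitAt-end {suc L} β = bitAt-end (β ∘ Fin.suc)

bitAt-<2 : ∀ {L} (β : Fin L → Fin 2) i → bitAt β i < 2
bitAt-<2 {zero} β i = s≤s z≤n
bitAt-<2 {suc L} β zero = toℕ<n (β Fin.zero)
bitAt-<2 {suc L} β (suc i) = bitAt-<2 (β ∘ Fin.suc) i

encode : ∀ {L} → (Fin L → Fin 2) → Word
encode β zero = 0
encode β (suc zero) = 2
encode β (suc (suc i)) = bitAt β i

Marked : Word → Set
Marked u = u 1 ≡ 2 × (∀ q → u q ≡ 2 → q ≡ 1)

encode-marked : ∀ {L} (β : Fin L → Fin 2) → Marked (encode β)
encode-marked β = refl , only
  where
  only : ∀ q → encode β q ≡ 2 → q ≡ 1
  only zero ()
  only (suc zero) _ = refl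
  only (suc (suc i)) is2 = contradiction is2 (<⇒≢ (bitAt-<2 β i))

splice : ℕ → Word → Word → Word
splice p u v q with q <? p
... | yes _ = u q
... | no _ = v (q ∸ p)

splice-< : ∀ {v} → q < p → splice p u v q ≡ u q
splice-< {q} {p} q<p with q <? p
... | yes _ = refl
... | no q≮p = contradiction q<p q≮p

splice-+ : ∀ {v} p t → splice p u v (p + t) ≡ v t
splice-+ {v = v} p t with p + t <? p
... | yes p+t<p = contradiction p+t<p (m+n≮m p t)
... | no _ = cong v (m+n∸m≡n p t)

splice-cases : ∀ p u v q →
  (q < p × splice p u v q ≡ u q) ⊎ Σ ℕ λ t → q ≡ p + t × splice p u v q ≡ v t
splice-cases p u v q with q <? p
... | yes q<p = inj₁ (q<p , refl)
... | no q≮p = inj₂ (q ∸ p , sym (m+[n∸m]≡n (≮⇒≥ q≮p)) , refl)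

probe : Word → ℕ → ℕ → Word
probe u p j = splice p u (splice (2 + j) u λ _ → u 0)

probe-copy : t < 2 + j → probe u p j (p + t) ≡ u t
probe-copy {t = t} {p = p} t<2+j = trans (splice-+ p t) (splice-< t<2+j)

probe-fill : 2 + j ≤ t → probe u p j (p + t) ≡ u 0
probe-fill {j = j} {t = t} {u = u} {p = p} 2+j≤t
  with splice-cases (2 + j) u (λ _ → u 0) t
... | inj₁ (t<2+j , _) = contradiction t<2+j (≤⇒≯ 2+j≤t)
... | inj₂ (_ , _ , filled) = trans (splice-+ p t) filled

probe-agrees : u p ≡ u 0 → q ≤ p → probe u p j q ≡ u q
probe-agrees {u = u} {p = p} {q = q} {j = j} up≡u0 q≤p with m≤n⇒m<n∨m≡n q≤p
... | inj₁ q<p = splice-< q<p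
... | inj₂ refl = begin
  probe u p j p        ≡⟨ cong (probe u p j) (+-identityʳ p) ⟨
  probe u p j (p + 0)  ≡⟨ probe-copy {u = u} {p = p} (s≤s z≤n) ⟩
  u 0                  ≡⟨ up≡u0 ⟨
  u p                  ∎
  where open ≡-Reasoning

probe-marker : Marked u → ∀ q → probe u p j q ≡ 2 → q ≡ 1 ⊎ q ≡ p + 1
probe-marker {u = u} {p = p} {j = j} (_ , only) q is2
  with splice-cases p u (splice (2 + j) u λ _ → u 0) q
... | inj₁ (_ , low) = inj₁ (only q (trans (sym low) is2))
... | inj₂ (t , refl , high) with splice-cases (2 + j) u (λ _ → u 0) t
...   | inj₁ (_ , copied) = inj₂ (cong (λ t′ → p + t′) (only t (trans (sym copied) (trans (sym high) is2))))
...   | inj₂ (_ , _ , filled) = contradiction (only 0 (trans (sym filled) (trans (sym high) is2))) λ ()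

first-border : Marked u → u (2 + j) ≡ u 0 → PiAt u (3 + j) 1
first-border (u₁ , only) repeat =
  longest-by-marker {p = 0} u₁ (λ q is2 → inj₁ (only q is2))
    (border1-intro (s≤s z≤n) (sym repeat)) ≤-refl
    λ c 3+j≡c bc → ⊥-elim (<-irrefl (sym 3+j≡c) (proj₁ bc))

first-strict : Marked u → u (2 + j) ≡ u 0 → Longest (IsStrictBorder u (3 + j)) 1
first-strict {j = j} marked@(u₁ , only) repeat =
  strictify (first-border marked repeat) λ same → contradiction (only (3 + j) (trans (sym same) u₁)) λ ()

module _ (u : Word) (marked : Marked u) (p j : ℕ) (2+j<p : 2 + j < p) where
  private
    word : Word
    word = probe u p j

    u₁ : u 1 ≡ 2
    u₁ = proj₁ marked

    only : ∀ q → u q ≡ 2 → q ≡ 1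
    only = proj₂ marked

    0<p : 0 < p
    0<p = <-trans (s≤s z≤n) 2+j<p

    w₁ : word 1 ≡ 2
    w₁ = trans (splice-< (<-trans (s≤s (s≤s z≤n)) 2+j<p)) u₁

    w-marker : ∀ q → word q ≡ 2 → q ≡ 1 ⊎ q ≡ p + 1
    w-marker = probe-marker marked

    w-bit : word (2 + j) ≡ u (2 + j)
    w-bit = splice-< 2+j<p

    w-end : word (p + (2 + j)) ≡ u 0
    w-end = probe-fill {u = u} {p = p} ≤-refl

  copy-border : PiAt (probe u p j) (p + (2 + j)) (2 + j)
  copy-border = longest-by-marker w₁ w-marker copy (s≤s z≤n) aligned
    where
    copy : IsBorder word (p + (2 + j)) (2 + j)
    copy = m<n+m (2 + j) 0<p , λ t t<2+j → begin
      word t                            ≡⟨ splice-< (<-trans t<2+j 2+j<p) ⟩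
      u t                               ≡⟨ probe-copy {u = u} {p = p} t<2+j ⟨
      word (p + t)                      ≡⟨ cong (λ s → word (s + t)) (m+n∸n≡m p (2 + j)) ⟨
      word (p + (2 + j) ∸ (2 + j) + t)  ∎
      where open ≡-Reasoning
    aligned : ∀ c → p + (2 + j) ≡ p + c → IsBorder word (p + (2 + j)) c → c ≤ 2 + j
    aligned c same _ = ≤-reflexive (sym (+-cancelˡ-≡ p (2 + j) c same))

  copy-strict : u (2 + j) ≢ u 0 → Longest (IsStrictBorder (probe u p j) (p + (2 + j))) (2 + j)
  copy-strict differ = strictify copy-border λ same → differ (trans (sym w-bit) (trans same w-end))

  -- If u (2 + j) differs from u 0 the copy cannot grow, so π[p+3+j] = 1.
  end-border : u (2 + j) ≢ u 0 → PiAt (probe u p j) (suc (p + (2 + j))) 1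
  end-border differ = longest-by-marker w₁ w-marker
    (border1-intro (≤-trans (s≤s z≤n) (m≤n+m (2 + j) p)) (trans (splice-< 0<p) (sym w-end)))
    ≤-refl aligned
    where
    longer : ¬ IsBorder word (suc (p + (2 + j))) (3 + j)
    longer (_ , match) = differ (begin
      u (2 + j)                               ≡⟨ w-bit ⟨
      word (2 + j)                            ≡⟨ match (2 + j) ≤-refl ⟩
      word (p + (2 + j) ∸ (2 + j) + (2 + j))  ≡⟨ cong (λ s → word (s + (2 + j))) (m+n∸n≡m p (2 + j)) ⟩
      word (p + (2 + j))                      ≡⟨ w-end ⟩
      u 0                                     ∎)
      where open ≡-Reasoning
    aligned : ∀ c → suc (p + (2 + j)) ≡ p + c → IsBorder word (suc (p + (2 + j))) c → c ≤ 1
    aligned c same bc with +-cancelˡ-≡ p (3 + j) c (trans (+-suc p (2 + j)) same)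
    ... | refl = contradiction bc longer

  end-strict : u (2 + j) ≢ u 0 → Longest (IsStrictBorder (probe u p j) (suc (p + (2 + j)))) 1
  end-strict differ = strictify (end-border differ) λ same →
    contradiction (only 0 (begin
      u 0                       ≡⟨ probe-fill {u = u} {p = p} (n≤1+n (2 + j)) ⟨
      word (p + (3 + j))        ≡⟨ cong word (+-suc p (2 + j)) ⟩
      word (suc (p + (2 + j)))  ≡⟨ same ⟨
      word 1                    ≡⟨ w₁ ⟩
      2                         ∎)) λ ()
    where open ≡-Reasoning

-- Why the mixed arrays are invalid

echo : IsBorder z (3 + j) 1 → IsBorder z (suc i) 1 → z (2 + j) ≡ z i
echo b₁ b₃ = trans (sym (border1 b₁)) (border1 b₃)

-- No word has a border 1 of z[0..3+j), a border 2+j of z[0..i) and longest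
-- border 1 of z[0..i]: the border 2+j would extend to a border 3+j of z[0..i].
pi-impossible : IsBorder z (3 + j) 1 → IsBorder z i (2 + j) → PiAt z (suc i) 1 → ⊥
pi-impossible b₁ b₂ (b₃ , maximal) =
  contradiction (maximal _ (border-extend b₂ (echo b₁ b₃))) λ { (s≤s ()) }

strict-impossible : IsBorder z (3 + j) 1 → IsStrictBorder z i (2 + j) → IsBorder z (suc i) 1 → ⊥
strict-impossible b₁ (_ , differ) b₃ = differ (echo b₁ b₃)

module _ {z : Word} {f g : ℕ → ℤ} where
  read-pi-left : Entrywise (PiEntry z) (window f 0 p ++ window g p r) →
    k < p → f k ≡ + v → PiAt z (suc k) v
  read-pi-left correct k<p fk =
    longestValue-+ (subst (PiEntry z _) fk (read-left {R = PiEntry z} {f = f} {g = g} correct k<p))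

  read-pi-right : Entrywise (PiEntry z) (window f 0 p ++ window g p r) →
    t < r → g (p + t) ≡ + v → PiAt z (suc (p + t)) v
  read-pi-right correct t<r gt =
    longestValue-+ (subst (PiEntry z _) gt (read-right {R = PiEntry z} {f = f} {g = g} correct t<r))

  read-strict-left : Entrywise (StrictEntry (p + r) z) (window f 0 p ++ window g p r) →
    k < p → suc k < p + r → f k ≡ + v → IsStrictBorder z (suc k) v
  read-strict-left {p = p} {r = r} {k = k} correct k<p not-last fk =
    proj₁ (longestOrNone-+ (subst (LongestOrNone (IsStrictBorder z (suc k))) fk strict))
    where
    strict : LongestOrNone (IsStrictBorder z (suc k)) (f k)
    strict = proj₂ (read-left {R = StrictEntry (p + r) z} {f = f} {g = g} correct k<p) not-last

  read-strict-right : Entrywise (StrictEntry (p + r) z) (window f 0 p ++ window g p r) →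
    t < r → suc (p + t) < p + r → g (p + t) ≡ + v → IsStrictBorder z (suc (p + t)) v
  read-strict-right {p = p} {r = r} {t = t} correct t<r not-last gt =
    proj₁ (longestOrNone-+ (subst (LongestOrNone (IsStrictBorder z (suc (p + t)))) gt strict))
    where
    strict : LongestOrNone (IsStrictBorder z (suc (p + t))) (g (p + t))
    strict = proj₂ (read-right {R = StrictEntry (p + r) z} {f = f} {g = g} correct t<r) not-last

-- The positions read by the conflicts: 2 + j in the prefix, and suc j, 2 + j
-- in the suffix, all strictly before the last entry when r ≥ 3 + L.
module Positions {L} (r : ℕ) (r-large : 3 + L ≤ r) (j : Fin L) where
  jₙ : ℕ
  jₙ = toℕ j

  first<P : 2 + jₙ < 2 + L
  first<P = s≤s (s≤s (toℕ<n j))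

  3+jₙ<r : 3 + jₙ < r
  3+jₙ<r = ≤-trans (s≤s (s≤s (s≤s (toℕ<n j)))) r-large

  last<r : 2 + jₙ < r
  last<r = <-trans (n<1+n (2 + jₙ)) 3+jₙ<r

  copy<r : suc jₙ < r
  copy<r = <-trans (n<1+n (suc jₙ)) last<r

  not-last : ∀ {t} → suc t < r → suc (2 + L + t) < 2 + L + r
  not-last {t} t+1<r = subst (_< 2 + L + r) (+-suc (2 + L) t) (+-monoʳ-< (2 + L) t+1<r)

  first-not-last : 3 + jₙ < 2 + L + r
  first-not-last = ≤-trans 3+jₙ<r (m≤n+m r (2 + L))

  -- the copy entry sits at index 2 + L + suc j, i.e. prefix length 2 + L + (2 + j)
  copy-length : suc (2 + L + suc jₙ) ≡ 2 + L + (2 + jₙ)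
  copy-length = sym (+-suc (2 + L) (suc jₙ))

  repeats : ∀ (β : Fin L → Fin 2) → β j ≡ 0F → encode β (2 + jₙ) ≡ encode β 0
  repeats β β0 = trans (bitAt-toℕ β j) (cong toℕ β0)

  differs : ∀ (γ : Fin L → Fin 2) → γ j ≡ 1F → encode γ (2 + jₙ) ≢ encode γ 0
  differs γ γ1 same = contradiction (trans (sym (cong toℕ γ1)) (trans (sym (bitAt-toℕ γ j)) same)) λ ()

pi-conflict : ∀ {L} r → 3 + L ≤ r → (β γ : Fin L → Fin 2) (j : Fin L) → β j ≡ 0F → γ j ≡ 1F →
  ¬ ValidPi (window (piEntry (encode β)) 0 (2 + L) ++
             window (piEntry (probe (encode γ) (2 + L) (toℕ j))) (2 + L) r)
pi-conflict {L} r r-large β γ j β0 γ1 (z , correct) = pi-impossible first copy last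
  where
  open Positions r r-large j
  first : IsBorder z (3 + jₙ) 1
  first = proj₁ (read-pi-left correct first<P
    (piEntry-≡ (first-border (encode-marked β) (repeats β β0))))
  copy : IsBorder z (2 + L + (2 + jₙ)) (2 + jₙ)
  copy = proj₁ (subst (λ i → PiAt z i (2 + jₙ)) copy-length
    (read-pi-right correct copy<r (piEntry-≡ probe-copy-entry)))
    where
    probe-copy-entry : PiAt (probe (encode γ) (2 + L) jₙ) (suc (2 + L + suc jₙ)) (2 + jₙ)
    probe-copy-entry = subst (λ i → PiAt (probe (encode γ) (2 + L) jₙ) i (2 + jₙ)) (sym copy-length)
      (copy-border (encode γ) (encode-marked γ) (2 + L) jₙ first<P)
  last : PiAt z (suc (2 + L + (2 + jₙ))) 1
  last = read-pi-right correct last<r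
    (piEntry-≡ (end-border (encode γ) (encode-marked γ) (2 + L) jₙ first<P (differs γ γ1)))

strict-conflict : ∀ {L} r → 3 + L ≤ r → (β γ : Fin L → Fin 2) (j : Fin L) → β j ≡ 0F → γ j ≡ 1F →
  ¬ ValidStrictPi (window (strictEntry (2 + L + r) (encode β)) 0 (2 + L) ++
                   window (strictEntry (2 + L + r) (probe (encode γ) (2 + L) (toℕ j))) (2 + L) r)
strict-conflict {L} r r-large β γ j β0 γ1 (z , correct) = strict-impossible first copy last
  where
  open Positions r r-large j
  n : ℕ
  n = 2 + L + r
  first : IsBorder z (3 + jₙ) 1
  first = proj₁ (read-strict-left correct first<P first-not-last
    (trans (strictEntry-< n _ _ first-not-last)
           (strictValue-≡ (first-strict (encode-marked β) (repeats β β0)))))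
  copy : IsStrictBorder z (2 + L + (2 + jₙ)) (2 + jₙ)
  copy = subst (λ i → IsStrictBorder z i (2 + jₙ)) copy-length
    (read-strict-right correct copy<r (not-last last<r)
      (trans (strictEntry-< n _ _ (not-last last<r)) (strictValue-≡ probe-copy-entry)))
    where
    probe-copy-entry : Longest (IsStrictBorder (probe (encode γ) (2 + L) jₙ) (suc (2 + L + suc jₙ))) (2 + jₙ)
    probe-copy-entry = subst (λ i → Longest (IsStrictBorder (probe (encode γ) (2 + L) jₙ) i) (2 + jₙ))
      (sym copy-length)
      (copy-strict (encode γ) (encode-marked γ) (2 + L) jₙ first<P (differs γ γ1))
  last : IsBorder z (suc (2 + L + (2 + jₙ))) 1
  last = proj₁ (read-strict-right correct last<r (not-last 3+jₙ<r)
    (trans (strictEntry-< n _ _ (not-last 3+jₙ<r))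
           (strictValue-≡ (end-strict (encode γ) (encode-marked γ) (2 + L) jₙ first<P (differs γ γ1)))))

border-fooling : ∀ {m} (A : Streaming m) L r {Prop : Vec ℤ (2 + L + r) → Set} →
  Decides A (2 + L + r) Prop → (E : Word → ℕ → ℤ) →
  (∀ {w w′} k → (∀ q → q ≤ suc k → w q ≡ w′ q) → E w k ≡ E w′ k) →
  (∀ w → Prop (window (E w) 0 (2 + L + r))) →
  (∀ (β γ : Fin L → Fin 2) j → β j ≡ 0F → γ j ≡ 1F →
     ¬ Prop (window (E (encode β)) 0 (2 + L) ++ window (E (probe (encode γ) (2 + L) (toℕ j))) (2 + L) r)) →
  L ≤ memoryBits m
border-fooling A L r {Prop} decides E E-local E-valid E-conflict =
  fooling-bound A decides (prefix ∘ bitsOf {L}) separable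
  where
  prefix : (Fin L → Fin 2) → Vec ℤ (2 + L)
  prefix β = window (E (encode β)) 0 (2 + L)

  suffix : (Fin L → Fin 2) → Fin L → Vec ℤ r
  suffix γ j = window (E (probe (encode γ) (2 + L) (toℕ j))) (2 + L) r

  -- the probe of γ starts like encode γ, so its array is prefix γ ++ suffix γ j
  probe-array : ∀ γ j → window (E (probe (encode γ) (2 + L) (toℕ j))) 0 (2 + L + r) ≡ prefix γ ++ suffix γ j
  probe-array γ j = trans (window-++ _ 0 (2 + L) r) (cong (_++ suffix γ j)
    (window-cong 0 (2 + L) λ k k<P → E-local k λ q q≤k+1 → probe-agrees (bitAt-end γ) (≤-trans q≤k+1 k<P)))

  separates : ∀ β γ j → β j ≡ 0F → γ j ≡ 1F → Separates A Prop (prefix γ) (prefix β) (suffix γ j)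
  separates β γ j β0 γ1 = subst Prop (probe-array γ j) (E-valid _) , E-conflict β γ j β0 γ1

  separable : ∀ k k′ → k ≢ k′ →
    Σ (Vec ℤ r) (Separates A Prop (prefix (bitsOf {L} k)) (prefix (bitsOf {L} k′)))
    ⊎ Σ (Vec ℤ r) (Separates A Prop (prefix (bitsOf {L} k′)) (prefix (bitsOf {L} k)))
  separable k k′ k≢k′ with differing-bit {L} k≢k′
  ... | j , differ with distinct-bits differ
  ...   | inj₁ (k0 , k′1) = inj₂ (suffix _ j , separates _ _ j k0 k′1)
  ...   | inj₂ (k1 , k′0) = inj₁ (suffix _ j , separates _ _ j k′0 k1)

length-split : ∀ n → 9 ≤ n → Σ ℕ λ L → Σ ℕ λ r → n ≡ 2 + L + r × 3 + L ≤ r × n ≤ 5 * L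
length-split n 9≤n = subst (λ n → Σ ℕ λ L → Σ ℕ λ r → n ≡ 2 + L + r × 3 + L ≤ r × n ≤ 5 * L)
                           (m+[n∸m]≡n 9≤n) (split (n ∸ 9))
  where
  split : ∀ d → Σ ℕ λ L → Σ ℕ λ r → 9 + d ≡ 2 + L + r × 3 + L ≤ r × 9 + d ≤ 5 * L
  split zero = 2 , 5 , refl , ≤-refl , m≤m+n 9 1
  split (suc zero) = 2 , 6 , refl , n≤1+n 5 , ≤-refl
  split (suc (suc d)) with split d
  ... | L , r , d-split , r-large , bound =
    suc L , suc r , trans (cong (λ x → 2 + x) d-split) (cong (λ x → 3 + x) (sym (+-suc L r))) , s≤s r-large ,
    ≤-trans (+-monoʳ-≤ 2 bound)
            (≤-trans (+-monoˡ-≤ (5 * L) (m≤m+n 2 3)) (≤-reflexive (sym (*-suc 5 L))))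

theorem2 : Σ ℕ λ k → Σ ℕ λ N → ∀ (n : ℕ) → N ≤ n → ∀ (m : ℕ) (A : Streaming m) →
    (Decides A n ValidPi → n ≤ k * memoryBits m)
    × (Decides A n ValidStrictPi → n ≤ k * memoryBits m)
theorem2 = 5 , 9 , λ n 9≤n m A →
  let (L , r , n-split , r-large , n≤5L) = length-split n 9≤n
      bits : L ≤ memoryBits m → n ≤ 5 * memoryBits m
      bits L≤bits = ≤-trans n≤5L (*-monoʳ-≤ 5 L≤bits)
  in (λ decides → bits (border-fooling A L r (subst (λ n → Decides A n ValidPi) n-split decides)
                    piEntry piEntry-local (piArray-valid _) (pi-conflict r r-large)))
   , (λ decides → bits (border-fooling A L r (subst (λ n → Decides A n ValidStrictPi) n-split decides)
                    (strictEntry (2 + L + r)) (strictEntry-local (2 + L + r))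
                    (strictArray-valid (2 + L + r)) (strict-conflict r r-large)))
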